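{- Let $G$ be a $K_4$-free bridged graph, $z$ a vertex of $G$ and $u$ any vertex of $G$. Then the metric projection $\Pi(u,N[z])$ consists of a single vertex or of two adjacent vertices. Moreover, suppose $d_G(u,z)=k+1$ and $\Pi(u,N[z])=\{y,y'\}$ with $y\neq y'$. Then there exists a unique vertex $x$ adjacent to both $y$ and $y'$ with $d_G(u,x)=k-1$.
   Context: All graphs are finite, simple, undirected and connected; $d_G$ denotes the shortest-path distance of $G$. A graph $G$ is bridged if every isometric cycle of $G$ has length $3$; a cycle $C$ is isometric if $d_C=d_G$ on its vertices. $G$ is $K_4$-free if it has no four pairwise adjacent vertices. $N[z]$ is the closed neighborhood of $z$. For $A\subseteq V$, $d_G(u,A)=\min_{a\in A}d_G(u,a)$, and the metric projection is $\Pi(u,A)=\{a\in A: d_G(u,a)=d_G(u,A)\}$. -}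

module Defs where

open import Data.Nat using (ℕ; zero; suc; _≤_; _⊓_; _∸_; ∣_-_∣)
open import Data.Fin using (Fin; toℕ)
open import Data.Product using (Σ; ∃; _×_; _,_)
open import Data.Sum using (_⊎_)
open import Data.Empty using (⊥)
open import Relation.Nullary using (¬_; Dec)
open import Relation.Binary.PropositionalEquality using (_≡_; _≢_)
open import Function.Definitions using (Injective)

record Graph : Set₁ where
  field
    n       : ℕ
    Adj     : Fin n → Fin n → Set
    Adj?    : ∀ u v → Dec (Adj u v)
    irrefl  : ∀ u → ¬ Adj u u
    sym     : ∀ {u v} → Adj u v → Adj v u

open Graph public

Vtx : Graph → Set
Vtx G = Fin (n G)

data Walk (G : Graph) : Vtx G → Vtx G → ℕ → Set where
  here : ∀ {u} → Walk G u u zero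
  step : ∀ {u v w k} → Adj G u v → Walk G v w k → Walk G u w (suc k)

Connected : Graph → Set
Connected G = ∀ u v → ∃ λ k → Walk G u v k

Dist : (G : Graph) → Vtx G → Vtx G → ℕ → Set
Dist G u v k = Walk G u v k × (∀ m → Walk G u v m → k ≤ m)

K4Free : Graph → Set
K4Free G = ∀ a b c d → Adj G a b → Adj G a c → Adj G a d
                     → Adj G b c → Adj G b d → Adj G c d → ⊥

record Cycle (G : Graph) (m : ℕ) : Set where
  field
    len≥3  : 3 ≤ m
    vtx    : Fin m → Vtx G
    inj    : Injective _≡_ _≡_ vtx
    adjacent : ∀ (i j : Fin m)
             → (suc (toℕ i) ≡ toℕ j ⊎ (suc (toℕ i) ≡ m × toℕ j ≡ 0))
             → Adj G (vtx i) (vtx j)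

cycDist : (m : ℕ) → ℕ → ℕ → ℕ
cycDist m i j = ∣ i - j ∣ ⊓ (m ∸ ∣ i - j ∣)

Isometric : (G : Graph) {m : ℕ} → Cycle G m → Set
Isometric G {m} C = ∀ (i j : Fin m) →
  Dist G (Cycle.vtx C i) (Cycle.vtx C j) (cycDist m (toℕ i) (toℕ j))

Bridged : Graph → Set
Bridged G = ∀ m (C : Cycle G m) → Isometric G C → m ≡ 3

InN : (G : Graph) → Vtx G → Vtx G → Set
InN G z a = a ≡ z ⊎ Adj G z a

InProj : (G : Graph) → Vtx G → Vtx G → Vtx G → Set
InProj G u z a = InN G z a × ∃ λ k → Dist G u a k ×
  (∀ b m → InN G z b → Dist G u b m → k ≤ m)

module Submission where

-- The heart of the proof is that every bridged graph G satisfies, for every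
-- base vertex o and every level K (levels are distances from o):
--   PredClique o K : the neighbours at level K of a vertex at level K+1 are
--                    pairwise adjacent, and
--   Triangle o K   : two adjacent vertices at level K+1 have a common
--                    neighbour at level K (the triangle condition).
-- Both are proved together by strong induction on K.  If one of them failed
-- at level L, two geodesics from o (to the two "bad" vertices) would close
-- up into a closed walk of length 2L+2, resp. 2L+3.  Using the conditions below level L,
-- one computes enough distances between opposite vertices of that cycle to
-- see that it is isometric; bridgedness then forces its length to be 3,
-- which is impossible.  The only further ingredient is that a 5-cycle whose
-- non-consecutive vertices are non-adjacent is isometric.

open import Defs
open import Data.Nat using (ℕ; zero; suc; _+_; _*_; _∸_; _≤_; _<_; _≤?_; z≤n; s≤s; _⊓_; NonZero; _≟_)
open import Data.Nat.Properties hiding (_≟_)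
open import Data.Nat.Induction using (<-rec)
open import Data.Nat.DivMod
open import Data.Nat.Base using (>-nonZero)
open import Data.Nat.Tactic.RingSolver using (solve-∀)
open import Data.Fin using (Fin; toℕ) renaming (_≟_ to _≟F_)
open import Data.Fin.Properties using (any?; toℕ-injective; toℕ<n)
open import Data.Product using (Σ; ∃; ∃!; _×_; _,_; proj₁; proj₂)
open import Data.Sum using (_⊎_; inj₁; inj₂)
open import Data.Empty using (⊥; ⊥-elim)
open import Function.Bundles using (_⇔_; mk⇔; Equivalence)
open import Function.Construct.Composition using (_⇔-∘_)
open import Relation.Nullary using (¬_; Dec; yes; no)
open import Relation.Nullary.Decidable using (_×-dec_; ¬?)
open import Relation.Binary.PropositionalEquality renaming (sym to ≡sym) hiding ([_])

least : (P : ℕ → Set) → (∀ k → Dec (P k)) → ∀ k → P k → Σ ℕ (λ j → P j × (∀ i → P i → j ≤ i))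
least P P? = <-rec (λ k → P k → Σ ℕ (λ j → P j × (∀ i → P i → j ≤ i))) search
  where
  search : ∀ k → (∀ {j} → j < k → P j → Σ ℕ (λ j → P j × (∀ i → P i → j ≤ i))) → P k
         → Σ ℕ (λ j → P j × (∀ i → P i → j ≤ i))
  search k smaller pk with anyUpTo? P? k
  ... | yes (j , j<k , pj) = smaller j<k pj
  ... | no none = k , pk , λ i pi → ≮⇒≥ (λ i<k → none (i , i<k , pi))

zero⊎suc : ∀ k → k ≡ 0 ⊎ Σ ℕ (λ j → k ≡ suc j)
zero⊎suc zero = inj₁ refl
zero⊎suc (suc j) = inj₂ (j , refl)

≥2⇒suc-suc : ∀ n → 2 ≤ n → Σ ℕ λ k → n ≡ suc (suc k)
≥2⇒suc-suc (suc (suc k)) _ = k , refl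
≥2⇒suc-suc (suc zero) (s≤s ())

module Metric (G : Graph) (conn : Connected G) where
  V : Set
  V = Vtx G

  infix 4 _~_
  _~_ : V → V → Set
  u ~ v = Adj G u v

  ~sym : ∀ {u v} → u ~ v → v ~ u
  ~sym = Graph.sym G

  ~irr : ∀ {u} → ¬ (u ~ u)
  ~irr {u} = irrefl G u

  _≟V_ : (u v : V) → Dec (u ≡ v)
  _≟V_ = _≟F_

  walk? : ∀ k u v → Dec (Walk G u v k)
  walk? zero u v with u ≟F v
  ... | yes refl = yes here
  ... | no ne = no λ { here → ne refl }
  walk? (suc k) u v with any? (λ w → Adj? G u w ×-dec walk? k w v)
  ... | yes (w , a , wk) = yes (step a wk)
  ... | no ne = no λ { (step {v = w} a wk) → ne (w , a , wk) }

  -- The distance is the least length of a walk; it is kept abstract so that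
  -- it never unfolds into the search that computes it.
  abstract
    shortest : ∀ u v → Σ ℕ λ k → Walk G u v k × (∀ m → Walk G u v m → k ≤ m)
    shortest u v = least (Walk G u v) (λ k → walk? k u v) (proj₁ (conn u v)) (proj₂ (conn u v))

  dist : V → V → ℕ
  dist u v = proj₁ (shortest u v)

  dist-walk : ∀ u v → Walk G u v (dist u v)
  dist-walk u v = proj₁ (proj₂ (shortest u v))

  dist-min : ∀ {u v m} → Walk G u v m → dist u v ≤ m
  dist-min {u} {v} {m} w = proj₂ (proj₂ (shortest u v)) m w

  dist-Dist : ∀ u v → Dist G u v (dist u v)
  dist-Dist u v = proj₂ (shortest u v)

  Dist-unique : ∀ {u v k} → Dist G u v k → k ≡ dist u v
  Dist-unique {u} {v} (w , mn) = ≤-antisym (mn _ (dist-walk u v)) (dist-min w)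

  walk-++ : ∀ {u v w k l} → Walk G u v k → Walk G v w l → Walk G u w (k + l)
  walk-++ here q = q
  walk-++ (step a p) q = step a (walk-++ p q)

  walk-reverse : ∀ {a b k} → Walk G a b k → Walk G b a k
  walk-reverse {k = k} p = subst (Walk G _ _) (+-identityʳ k) (onto p here)
    where
    onto : ∀ {a b c k l} → Walk G a b k → Walk G a c l → Walk G b c (k + l)
    onto here acc = acc
    onto {k = suc k} {l = l} (step a p) acc = subst (Walk G _ _) (+-suc k l) (onto p (step (~sym a) acc))

  dist-sym : ∀ u v → dist u v ≡ dist v u
  dist-sym u v = ≤-antisym (dist-min (walk-reverse (dist-walk v u))) (dist-min (walk-reverse (dist-walk u v)))

  dist-tri : ∀ u v w → dist u w ≤ dist u v + dist v w
  dist-tri u v w = dist-min (walk-++ (dist-walk u v) (dist-walk v w))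

  dist-self : ∀ u → dist u u ≡ 0
  dist-self u = n≤0⇒n≡0 (dist-min (here {u = u}))

  dist0 : ∀ {u v} → dist u v ≡ 0 → u ≡ v
  dist0 {u} {v} eq = length0 (subst (Walk G u v) eq (dist-walk u v))
    where
    length0 : ∀ {u v} → Walk G u v 0 → u ≡ v
    length0 here = refl

  dist1 : ∀ {u v} → dist u v ≡ 1 → u ~ v
  dist1 {u} {v} eq = length1 (subst (Walk G u v) eq (dist-walk u v))
    where
    length1 : ∀ {u v} → Walk G u v 1 → u ~ v
    length1 (step a here) = a

  adj-dist : ∀ {u v} → u ~ v → dist u v ≡ 1
  adj-dist {u} {v} a with dist u v in eq
  ... | zero = ⊥-elim (~irr (subst (u ~_) (≡sym (dist0 eq)) a))
  ... | suc k = cong suc (n≤0⇒n≡0 (≤-pred (subst (_≤ 1) eq (dist-min (step a here)))))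

  dist≥2 : ∀ {u v} → u ≢ v → ¬ (u ~ v) → 2 ≤ dist u v
  dist≥2 {u} {v} ne na with dist u v in eq
  ... | zero = ⊥-elim (ne (dist0 eq))
  ... | suc zero = ⊥-elim (na (dist1 eq))
  ... | suc (suc k) = s≤s (s≤s z≤n)

  dist2 : ∀ {u v z} → u ≢ v → ¬ (u ~ v) → u ~ z → z ~ v → dist u v ≡ 2
  dist2 ne na a1 a2 = ≤-antisym (dist-min (step a1 (step a2 here))) (dist≥2 ne na)

  dist-adj≤ : ∀ o {u v} → u ~ v → dist o v ≤ suc (dist o u)
  dist-adj≤ o {u} {v} a = subst (dist o v ≤_) (+-comm (dist o u) 1)
    (subst (λ z → dist o v ≤ dist o u + z) (adj-dist a) (dist-tri o u v))

  dist-adj≥ : ∀ o {u v} → u ~ v → dist o u ≤ suc (dist o v)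
  dist-adj≥ o a = dist-adj≤ o (~sym a)

  walk-uncons : ∀ {v b d} → Walk G v b (suc d) → Σ V λ w → v ~ w × Walk G w b d
  walk-uncons (step a r) = _ , a , r

  predecessor : ∀ b v d → dist b v ≡ suc d → Σ V λ w → w ~ v × dist b w ≡ d
  predecessor b v d eq with walk-uncons (subst (Walk G v b) (trans (dist-sym v b) eq) (dist-walk v b))
  ... | w , a , r = w , ~sym a , ≤-antisym (dist-min (walk-reverse r))
                      (≤-pred (subst (_≤ suc (dist b w)) eq (dist-adj≤ b (~sym a))))

  levels≢ : ∀ o {u v} → dist o u ≢ dist o v → u ≢ v
  levels≢ o ne refl = ne refl

  far⇒≢ : ∀ o {u v} → suc (suc (dist o u)) ≤ dist o v → u ≢ v
  far⇒≢ o {u} le refl = 1+n≰n (≤-trans (n≤1+n _) le)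

  far⇒≁ : ∀ o {u v} → suc (suc (dist o u)) ≤ dist o v → ¬ (u ~ v)
  far⇒≁ o le a = 1+n≰n (≤-trans le (dist-adj≤ o a))

  far⇒≁' : ∀ o {u v} → suc (suc (dist o u)) ≤ dist o v → ¬ (v ~ u)
  far⇒≁' o le a = far⇒≁ o le (~sym a)

  between : ∀ o {a c t s} → dist o c ≡ s → dist o a ≡ suc (suc s) → t ~ a → c ~ t → dist o t ≡ suc s
  between o {a} {c} {t} dc da ta ct =
    ≤-antisym (subst (dist o t ≤_) (cong suc dc) (dist-adj≤ o ct))
              (≤-pred (subst (_≤ suc (dist o t)) da (dist-adj≤ o ta)))

  two-below : ∀ o u v {k} → dist o v ≡ suc (suc k) → dist o u ≡ k → suc (suc (dist o u)) ≤ dist o v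
  two-below o u v dv du = ≤-reflexive (trans (cong (λ z → suc (suc z)) du) (≡sym dv))

  level-gap : ∀ o u v p d → dist o u ≡ p → dist o v ≡ p + d → d ≤ dist u v
  level-gap o u v p d e1 e2 = +-cancelˡ-≤ p _ _ (subst₂ _≤_ e2 (cong (_+ dist u v) e1) (dist-tri o u v))

-- Geodesics from a base vertex b, as sequences X 0 = b, …, X L = v in which
-- X k lies on level k.  They are modified pointwise in the induction, so a
-- geodesic is any function ℕ → V with these properties on [0, L].
module Geodesics (G : Graph) (conn : Connected G) where
  open Metric G conn

  record Geo (b v : V) (L : ℕ) (X : ℕ → V) : Set where
    field
      end : X L ≡ v
      lev : ∀ k → k ≤ L → dist b (X k) ≡ k
      adj : ∀ k → k < L → X k ~ X (suc k)

  geo-start : ∀ {b v L X} → Geo b v L X → X 0 ≡ b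
  geo-start g = ≡sym (dist0 (Geo.lev g 0 z≤n))

  extend : (ℕ → V) → ℕ → V → ℕ → V
  extend X d v k with k ≤? d
  ... | yes _ = X k
  ... | no _ = v

  extend-≤ : ∀ X d v k → k ≤ d → extend X d v k ≡ X k
  extend-≤ X d v k le with k ≤? d
  ... | yes _ = refl
  ... | no nle = ⊥-elim (nle le)

  extend-> : ∀ X d v k → d < k → extend X d v k ≡ v
  extend-> X d v k lt with k ≤? d
  ... | yes le = ⊥-elim (<⇒≱ lt le)
  ... | no _ = refl

  geo-level : ∀ {b v L X} → Geo b v L X → dist b v ≡ L
  geo-level {b} g = trans (cong (dist b) (≡sym (Geo.end g))) (Geo.lev g _ ≤-refl)

  geo-extend : ∀ {b v w d X} → Geo b v d X → v ~ w → dist b w ≡ suc d → Geo b w (suc d) (extend X d w)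
  geo-extend {b} {v} {w} {d} {X} g a dw = record { end = extend-> X d w (suc d) ≤-refl ; lev = lv ; adj = ad }
    where
    module g = Geo g
    lv : ∀ k → k ≤ suc d → dist b (extend X d w k) ≡ k
    lv k le with m≤n⇒m<n∨m≡n le
    ... | inj₁ (s≤s k≤d) = trans (cong (dist b) (extend-≤ X d w k k≤d)) (g.lev k k≤d)
    ... | inj₂ refl = trans (cong (dist b) (extend-> X d w (suc d) ≤-refl)) dw
    ad : ∀ k → k < suc d → extend X d w k ~ extend X d w (suc k)
    ad k (s≤s k≤d) with m≤n⇒m<n∨m≡n k≤d
    ... | inj₁ k<d = subst₂ _~_ (≡sym (extend-≤ X d w k k≤d)) (≡sym (extend-≤ X d w (suc k) k<d)) (g.adj k k<d)
    ... | inj₂ refl = subst₂ _~_ (≡sym (extend-≤ X d w k k≤d)) (≡sym (extend-> X d w (suc k) ≤-refl))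
                        (subst (_~ w) (≡sym g.end) a)

  -- Every vertex at distance d from b is the end of a geodesic from b (kept
  -- abstract: only its existence matters).
  abstract
    geodesic : ∀ b v d → dist b v ≡ d → Σ (ℕ → V) λ X → Geo b v d X
    geodesic b v zero eq = (λ _ → v) , record { end = refl ; lev = lv ; adj = λ k () }
      where
      lv : ∀ k → k ≤ 0 → dist b v ≡ k
      lv .zero z≤n = eq
    geodesic b v (suc d) eq with predecessor b v d eq
    ... | w , a , dw with geodesic b w d dw
    ...   | X , g = extend X d v , geo-extend g a eq

  path-walk : (f : ℕ → V) → ∀ i d → (∀ k → i ≤ k → k < i + d → f k ~ f (suc k)) → Walk G (f i) (f (i + d)) d
  path-walk f i zero h = subst (λ z → Walk G (f i) (f z) 0) (≡sym (+-identityʳ i)) here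
  path-walk f i (suc d) h = step (h i ≤-refl (m<m+n i (s≤s z≤n)))
    (subst (λ z → Walk G (f (suc i)) (f z) d) (≡sym (+-suc i d))
      (path-walk f (suc i) d (λ k i<k k<e → h k (<⇒≤ i<k) (subst (k <_) (≡sym (+-suc i d)) k<e))))

  geo-dist : ∀ {b v L X} → Geo b v L X → ∀ i d → i + d ≤ L → dist (X i) (X (i + d)) ≡ d
  geo-dist {b} {v} {L} {X} g i d le = ≤-antisym up lo
    where
    module g = Geo g
    up : dist (X i) (X (i + d)) ≤ d
    up = dist-min (path-walk X i d (λ k _ k<e → g.adj k (<-≤-trans k<e le)))
    lo : d ≤ dist (X i) (X (i + d))
    lo = level-gap b (X i) (X (i + d)) i d (g.lev i (≤-trans (m≤m+n i d) le)) (g.lev (i + d) le)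

  update : (ℕ → V) → ℕ → V → ℕ → V
  update Y p t k with k ≟ p
  ... | yes _ = t
  ... | no _ = Y k

  update-at : ∀ Y p t → update Y p t p ≡ t
  update-at Y p t with p ≟ p
  ... | yes _ = refl
  ... | no ne = ⊥-elim (ne refl)

  update-ne : ∀ Y p t k → k ≢ p → update Y p t k ≡ Y k
  update-ne Y p t k ne with k ≟ p
  ... | yes e = ⊥-elim (ne e)
  ... | no _ = refl

  geo-update-end : ∀ {b v L q Y t} → Geo b v L Y → suc q ≡ L → dist b t ≡ L → Y q ~ t → Geo b t L (update Y L t)
  geo-update-end {b} {v} {.(suc q)} {q} {Y} {t} g refl dt a = record { end = update-at Y (suc q) t ; lev = lv ; adj = ad }
    where
    module g = Geo g
    lv : ∀ k → k ≤ suc q → dist b (update Y (suc q) t k) ≡ k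
    lv k le with k ≟ suc q
    ... | yes e = trans dt (≡sym e)
    ... | no ne = g.lev k le
    ad : ∀ k → k < suc q → update Y (suc q) t k ~ update Y (suc q) t (suc k)
    ad k (s≤s le) with k ≟ suc q | suc k ≟ suc q
    ... | yes e | _ = ⊥-elim (1+n≰n (subst (_≤ q) e le))
    ... | no _ | yes e = subst (λ z → Y z ~ t) (≡sym (suc-injective e)) a
    ... | no _ | no ne = g.adj k (s≤s le)

  geo-update-inner : ∀ {b v L Y t} p → Geo b v L Y → suc p < L → dist b t ≡ suc p → Y p ~ t → t ~ Y (suc (suc p)) →
                     Geo b v L (update Y (suc p) t)
  geo-update-inner {b} {v} {L} {Y} {t} p g lt dt a1 a2 = record { end = en ; lev = lv ; adj = ad }
    where
    module g = Geo g
    en : update Y (suc p) t L ≡ v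
    en = trans (update-ne Y (suc p) t L (λ e → <⇒≢ lt (≡sym e))) g.end
    lv : ∀ k → k ≤ L → dist b (update Y (suc p) t k) ≡ k
    lv k le with k ≟ suc p
    ... | yes e = trans dt (≡sym e)
    ... | no ne = g.lev k le
    ad : ∀ k → k < L → update Y (suc p) t k ~ update Y (suc p) t (suc k)
    ad k le with k ≟ suc p | suc k ≟ suc p
    ... | yes refl | yes e = ⊥-elim (1+n≢n e)
    ... | yes refl | no ne = a2
    ... | no ne | yes e = subst (λ z → Y z ~ t) (≡sym (suc-injective e)) a1
    ... | no ne | no ne' = g.adj k le

module IsometricCycles (G : Graph) (conn : Connected G) (br : Bridged G) where
  open Metric G conn
  open Geodesics G conn

  -- A closed walk of length m = h + r with h ≤ r ≤ h + 1 and m ≥ 3, given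
  -- as an m-periodic sequence c, in which every two vertices h steps apart
  -- are at distance ≥ h, is an isometric cycle; so m = 3.
  module Criterion (h r : ℕ) (h≤r : h ≤ r) (r≤h1 : r ≤ suc h) (3≤m : 3 ≤ h + r)
         (c : ℕ → V) (per : ∀ k → c (k + (h + r)) ≡ c k) (cadj : ∀ k → c k ~ c (suc k))
         (far : ∀ p → p < h + r → h ≤ dist (c p) (c (p + h))) where

    m : ℕ
    m = h + r

    instance
      m-nonZero : NonZero m
      m-nonZero = >-nonZero (≤-trans (s≤s z≤n) 3≤m)

    per-many : ∀ k q → c (k + q * m) ≡ c k
    per-many k zero = cong c (+-identityʳ k)
    per-many k (suc q) = trans (cong c (shift k q)) (trans (per (k + q * m)) (per-many k q))
      where
      shift : ∀ k q → k + (m + q * m) ≡ k + q * m + m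
      shift k q = trans (≡sym (+-assoc k m (q * m))) (trans (cong (_+ q * m) (+-comm k m))
                    (trans (+-assoc m k (q * m)) (+-comm m (k + q * m))))

    reduce : ∀ p → c p ≡ c (p % m)
    reduce p = trans (cong c (m≡m%n+[m/n]*n p m)) (per-many (p % m) (p / m))

    far-all : ∀ p → h ≤ dist (c p) (c (p + h))
    far-all p = subst₂ (λ a b → h ≤ dist a b) (≡sym (reduce p)) e2 (far (p % m) (m%n<n p m))
      where
      e2 : c (p % m + h) ≡ c (p + h)
      e2 = trans (≡sym (per-many (p % m + h) (p / m)))
            (cong c (trans (+-assoc (p % m) h _) (trans (cong (p % m +_) (+-comm h _))
              (trans (≡sym (+-assoc (p % m) _ h)) (cong (_+ h) (≡sym (m≡m%n+[m/n]*n p m)))))))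

    along : ∀ a l → dist (c a) (c (a + l)) ≤ l
    along a l = dist-min (path-walk c a l (λ k _ _ → cadj k))

    -- A segment of length l ≤ h is geodesic: otherwise, closing it up with
    -- the rest of the cycle would shortcut the pair h steps apart.
    segment-geodesic : ∀ a l → l ≤ h → dist (c a) (c (a + l)) ≡ l
    segment-geodesic a l l≤h with m≤n⇒∃[o]m+o≡n l≤h
    ... | s , eq = ≤-antisym (along a l) (+-cancelʳ-≤ s l _ (≤-trans (subst (_≤ dist (c q) (c (q + h))) (≡sym eq) (far-all q)) chain))
      where
      q : ℕ
      q = a + l + r
      e1 : c (q + h) ≡ c (a + l)
      e1 = trans (cong c (trans (+-assoc (a + l) r h) (cong (a + l +_) (+-comm r h)))) (per (a + l))
      e2 : c (q + s) ≡ c a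
      e2 = trans (cong c (trans (trans (+-assoc (a + l) r s) (trans (cong (a + l +_) (+-comm r s))
             (trans (≡sym (+-assoc (a + l) s r)) (cong (_+ r) (trans (+-assoc a l s) (cong (a +_) eq))))))
             (+-assoc a h r))) (per a)
      chain : dist (c q) (c (q + h)) ≤ dist (c a) (c (a + l)) + s
      chain = begin
        dist (c q) (c (q + h)) ≡⟨ cong (dist (c q)) e1 ⟩
        dist (c q) (c (a + l)) ≤⟨ dist-tri (c q) (c a) (c (a + l)) ⟩
        dist (c q) (c a) + dist (c a) (c (a + l)) ≤⟨ +-monoˡ-≤ _ (subst (λ z → dist (c q) z ≤ s) e2 (along q s)) ⟩
        s + dist (c a) (c (a + l)) ≡⟨ +-comm s _ ⟩
        dist (c a) (c (a + l)) + s ∎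
        where open ≤-Reasoning

    dist-forward : ∀ I D → I + D < m → dist (c I) (c (I + D)) ≡ D ⊓ (m ∸ D)
    dist-forward I D lt with D ≤? h
    ... | yes D≤h = trans (segment-geodesic I D D≤h)
                      (≡sym (m≤n⇒m⊓n≡m (m+n≤o⇒m≤o∸n D (≤-trans (+-mono-≤ D≤h D≤h) (+-monoʳ-≤ h h≤r)))))
    ... | no D≰h with m≤n⇒∃[o]m+o≡n (<⇒≤ (≤-trans (s≤s (m≤n+m D I)) lt))
    ...   | e , De≡m = trans (dist-sym (c I) (c (I + D)))
                        (trans (subst (λ z → dist (c (I + D)) z ≡ e) ceq (segment-geodesic (I + D) e e≤h))
                          (≡sym (trans (cong (D ⊓_) m∸D) (m≥n⇒m⊓n≡n (≤-trans e≤h (<⇒≤ (≰⇒> D≰h)))))))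
      where
      m∸D : m ∸ D ≡ e
      m∸D = trans (cong (_∸ D) (≡sym De≡m)) (m+n∸m≡n D e)
      e≤h : e ≤ h
      e≤h = +-cancelˡ-≤ (suc h) e h (≤-trans (+-monoˡ-≤ e (≰⇒> D≰h))
              (subst (_≤ suc h + h) (≡sym De≡m) (subst (h + r ≤_) (+-comm h (suc h)) (+-monoʳ-≤ h r≤h1))))
      ceq : c (I + D + e) ≡ c I
      ceq = trans (cong c (trans (+-assoc I D e) (cong (I +_) De≡m))) (per I)

    dist-cyc : ∀ I J → I < m → J < m → dist (c I) (c J) ≡ cycDist m I J
    dist-cyc I J I<m J<m with ≤-total I J
    ... | inj₁ I≤J with m≤n⇒∃[o]m+o≡n I≤J
    ...   | D , refl = trans (dist-forward I D J<m) (≡sym (cong (λ z → z ⊓ (m ∸ z)) (∣m-m+n∣≡n I D)))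
    dist-cyc I J I<m J<m | inj₂ J≤I with m≤n⇒∃[o]m+o≡n J≤I
    ...   | D , refl = trans (dist-sym (c (J + D)) (c J)) (trans (dist-forward J D I<m)
                         (≡sym (cong (λ z → z ⊓ (m ∸ z)) (trans (∣-∣-comm (J + D) J) (∣m-m+n∣≡n J D)))))

    cycDist≡0 : ∀ D → D < m → D ⊓ (m ∸ D) ≡ 0 → D ≡ 0
    cycDist≡0 D D<m eq with ≤-total D (m ∸ D)
    ... | inj₁ le = trans (≡sym (m≤n⇒m⊓n≡m le)) eq
    ... | inj₂ ge = ⊥-elim (<⇒≱ D<m (subst (_≤ D) (m∸n+n≡m (<⇒≤ D<m))
                      (subst (λ z → z + D ≤ D) (≡sym (trans (≡sym (m≥n⇒m⊓n≡n ge)) eq)) ≤-refl)))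

    vertex : Fin m → V
    vertex i = c (toℕ i)

    vertex-injective : ∀ {i j} → vertex i ≡ vertex j → i ≡ j
    vertex-injective {i} {j} eq = toℕ-injective (∣m-n∣≡0⇒m≡n (cycDist≡0 _
      (≤-<-trans (∣m-n∣≤m⊔n (toℕ i) (toℕ j)) (⊔-lub (toℕ<n i) (toℕ<n j)))
      (trans (≡sym (dist-cyc (toℕ i) (toℕ j) (toℕ<n i) (toℕ<n j))) (trans (cong (dist (vertex i)) (≡sym eq)) (dist-self _)))))

    vertex-adjacent : ∀ (i j : Fin m) → (suc (toℕ i) ≡ toℕ j ⊎ (suc (toℕ i) ≡ m × toℕ j ≡ 0)) → vertex i ~ vertex j
    vertex-adjacent i j (inj₁ eq) = subst (λ z → c (toℕ i) ~ c z) eq (cadj (toℕ i))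
    vertex-adjacent i j (inj₂ (e1 , e2)) = subst (c (toℕ i) ~_) (trans (cong c e1) (trans (per 0) (cong c (≡sym e2)))) (cadj (toℕ i))

    cycle : Cycle G m
    cycle = record { len≥3 = 3≤m ; vtx = vertex ; inj = vertex-injective ; adjacent = vertex-adjacent }

    isometric : Isometric G cycle
    isometric i j = subst (Dist G (vertex i) (vertex j)) (dist-cyc (toℕ i) (toℕ j) (toℕ<n i) (toℕ<n j))
                      (dist-Dist (vertex i) (vertex j))

    length≡3 : h + r ≡ 3
    length≡3 = br m cycle isometric

  module Periodic (f : ℕ → V) (m : ℕ) .{{_ : NonZero m}} where
    c : ℕ → V
    c k = f (k % m)

    per : ∀ k → c (k + m) ≡ c k
    per k = cong f ([m+n]%n≡m%n k m)

    small : ∀ k → k < m → c k ≡ f k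
    small k lt = cong f (m<n⇒m%n≡m lt)

    cadj : (∀ k → suc k < m → f k ~ f (suc k)) → (∀ k → suc k ≡ m → f k ~ f 0) → ∀ k → c k ~ c (suc k)
    cadj h1 h2 k = subst (f (k % m) ~_) (cong f (≡sym e)) (wrap (m≤n⇒m<n∨m≡n (m%n<n k m)))
      where
      e : suc k % m ≡ suc (k % m) % m
      e = trans (cong (λ z → suc z % m) (m≡m%n+[m/n]*n k m)) ([m+kn]%n≡m%n (suc (k % m)) (k / m) m)
      wrap : suc (k % m) < m ⊎ suc (k % m) ≡ m → f (k % m) ~ f (suc (k % m) % m)
      wrap (inj₁ lt) = subst (f (k % m) ~_) (cong f (≡sym (m<n⇒m%n≡m lt))) (h1 (k % m) lt)
      wrap (inj₂ eq) = subst (f (k % m) ~_) (cong f (≡sym (trans (cong (_% m) eq) (n%n≡0 m)))) (h2 (k % m) eq)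

  module Pentagon (v0 v1 v2 v3 v4 : V) (a01 : v0 ~ v1) (a12 : v1 ~ v2) (a23 : v2 ~ v3) (a34 : v3 ~ v4) (a40 : v4 ~ v0)
      (d02 : 2 ≤ dist v0 v2) (d13 : 2 ≤ dist v1 v3) (d24 : 2 ≤ dist v2 v4) (d30 : 2 ≤ dist v3 v0) (d41 : 2 ≤ dist v4 v1) where
    f : ℕ → V
    f 0 = v0
    f 1 = v1
    f 2 = v2
    f 3 = v3
    f _ = v4

    open Periodic f 5

    step-adj : ∀ k → suc k < 5 → f k ~ f (suc k)
    step-adj 0 _ = a01
    step-adj 1 _ = a12
    step-adj 2 _ = a23
    step-adj 3 _ = a34
    step-adj (suc (suc (suc (suc k)))) (s≤s (s≤s (s≤s (s≤s (s≤s ())))))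

    close-adj : ∀ k → suc k ≡ 5 → f k ~ f 0
    close-adj 4 refl = a40

    far : ∀ p → p < 2 + 3 → 2 ≤ dist (c p) (c (p + 2))
    far 0 _ = d02
    far 1 _ = d13
    far 2 _ = d24
    far 3 _ = d30
    far 4 _ = d41
    far (suc (suc (suc (suc (suc p))))) (s≤s (s≤s (s≤s (s≤s (s≤s ())))))

    impossible : ⊥
    impossible with Criterion.length≡3 2 3 (s≤s (s≤s z≤n)) ≤-refl (s≤s (s≤s (s≤s z≤n))) c per (cadj step-adj close-adj) far
    ... | ()

  module Bigon (h r P R : ℕ) (eqm : h + r ≡ suc (P + R)) (1≤R : 1 ≤ R) (A B : ℕ → V) (A0B0 : A 0 ≡ B 0)
       (aA : ∀ k → k < P → A k ~ A (suc k)) (aB : ∀ k → k < R → B k ~ B (suc k)) (top : A P ~ B R) where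
    m : ℕ
    m = h + r

    f : ℕ → V
    f k with k ≤? P
    ... | yes _ = A k
    ... | no _ = B (m ∸ k)

    f-A : ∀ k → k ≤ P → f k ≡ A k
    f-A k le with k ≤? P
    ... | yes _ = refl
    ... | no nle = ⊥-elim (nle le)

    f-B : ∀ k j → k + j ≡ m → j ≤ R → f k ≡ B j
    f-B k j eq j≤R with k ≤? P
    ... | yes le = ⊥-elim (<⇒≱ P<k le)
      where
      P<k : P < k
      P<k = +-cancelʳ-≤ R (suc P) k (≤-trans (≤-reflexive (≡sym eqm)) (subst (_≤ k + R) eq (+-monoʳ-≤ k j≤R)))
    ... | no _ = cong B (trans (cong (_∸ k) (≡sym eq)) (m+n∸m≡n k j))

    instance
      m-nonZero : NonZero m
      m-nonZero = >-nonZero (subst (0 <_) (≡sym eqm) (s≤s z≤n))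

    open Periodic f m public

    step-adj : ∀ k → suc k < m → f k ~ f (suc k)
    step-adj k lt = by-position (suc k ≤? P)
      where
      by-position : Dec (suc k ≤ P) → f k ~ f (suc k)
      by-position (yes le) = subst₂ _~_ (≡sym (f-A k (≤-trans (n≤1+n k) le))) (≡sym (f-A (suc k) le)) (aA k le)
      by-position (no nle) with m≤n⇒m<n∨m≡n (≤-pred (≰⇒> nle))
      ... | inj₂ refl = subst₂ _~_ (≡sym (f-A k ≤-refl)) (≡sym (f-B (suc k) R (≡sym eqm) ≤-refl)) top
      ... | inj₁ P<k with m≤n⇒∃[o]m+o≡n lt
      ...   | o , eq = subst₂ _~_ (≡sym (f-B k (suc (suc o)) e2 jR2)) (≡sym (f-B (suc k) (suc o) e1 (≤-trans (n≤1+n _) jR2)))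
                           (~sym (aB (suc o) jR2))
        where
        e1 : suc k + suc o ≡ m
        e1 = trans (+-suc (suc k) o) eq
        e2 : k + suc (suc o) ≡ m
        e2 = trans (+-suc k (suc o)) e1
        jR2 : suc (suc o) ≤ R
        jR2 = +-cancelˡ-≤ (suc P) _ _ (subst (suc P + suc (suc o) ≤_) (trans e2 eqm) (+-monoˡ-≤ (suc (suc o)) P<k))

    close-adj : ∀ k → suc k ≡ m → f k ~ f 0
    close-adj k eq = subst₂ _~_ (≡sym (f-B k 1 (trans (+-comm k 1) eq) 1≤R)) (≡sym (trans (f-A 0 z≤n) A0B0)) (~sym (aB 0 1≤R))

    cA : ∀ k → k ≤ P → c k ≡ A k
    cA k le = trans (small k (≤-<-trans le (subst (P <_) (≡sym eqm) (s≤s (m≤m+n P R))))) (f-A k le)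

    cB : ∀ k j → k + j ≡ m → 1 ≤ j → j ≤ R → c k ≡ B j
    cB k j eq 1≤j j≤R = trans (small k (subst (k <_) eq (m<m+n k 1≤j))) (f-B k j eq j≤R)

    -- Being longer than a triangle, the closed walk cannot have all pairs of
    -- vertices h steps apart at distance ≥ h.
    unbalanced : h ≤ r → r ≤ suc h → 2 ≤ h → ¬ (∀ p → p < m → h ≤ dist (c p) (c (p + h)))
    unbalanced h≤r r≤h1 2≤h far =
      1+n≰n (subst (4 ≤_) (Criterion.length≡3 h r h≤r r≤h1 (≤-trans (n≤1+n 3) 4≤m) c per (cadj step-adj close-adj) far) 4≤m)
      where
      4≤m : 4 ≤ m
      4≤m = +-mono-≤ 2≤h (≤-trans 2≤h h≤r)

module LocalConditions (G : Graph) (conn : Connected G) where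
  open Metric G conn

  PredClique : V → ℕ → Set
  PredClique o K = ∀ w x y → dist o w ≡ suc K → dist o x ≡ K → dist o y ≡ K → x ~ w → y ~ w → x ≢ y → x ~ y

  Triangle : V → ℕ → Set
  Triangle o K = ∀ y y' → dist o y ≡ suc K → dist o y' ≡ suc K → y ~ y' → Σ V λ t → t ~ y × t ~ y' × dist o t ≡ K

  one-of-three : ∀ K x → K ≤ x → x ≤ suc (suc K) → x ≡ K ⊎ x ≡ suc K ⊎ x ≡ suc (suc K)
  one-of-three zero zero _ _ = inj₁ refl
  one-of-three zero (suc zero) _ _ = inj₂ (inj₁ refl)
  one-of-three zero (suc (suc zero)) _ _ = inj₂ (inj₂ refl)
  one-of-three zero (suc (suc (suc x))) _ (s≤s (s≤s ()))
  one-of-three (suc K) zero () _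
  one-of-three (suc K) (suc x) (s≤s le) (s≤s ge) with one-of-three K x le ge
  ... | inj₁ e = inj₁ (cong suc e)
  ... | inj₂ (inj₁ e) = inj₂ (inj₁ (cong suc e))
  ... | inj₂ (inj₂ e) = inj₂ (inj₂ (cong suc e))

  no-descent : ∀ {o K a bb c} → PredClique o K → dist o a ≡ K → dist o bb ≡ suc K → a ~ bb → bb ~ c → a ≢ c → ¬ (a ~ c) →
               suc K ≤ dist o c
  no-descent {o} {K} {a} {bb} {c} q da dbb ab bc ne na with m≤n⇒m<n∨m≡n (≤-pred (subst (_≤ suc (dist o c)) dbb (dist-adj≥ o bc)))
  ... | inj₁ lt = lt
  ... | inj₂ eq = ⊥-elim (na (q bb a c dbb da (≡sym eq) ab (~sym bc) ne))

  ascent-or-apex : ∀ {o K a bb c} → PredClique o K → Triangle o K → dist o a ≡ K → dist o bb ≡ suc K → a ~ bb → bb ~ c →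
                   a ≢ c → ¬ (a ~ c) → dist o c ≡ suc (suc K) ⊎ Σ V λ t → t ~ a × t ~ bb × t ~ c × dist o t ≡ K
  ascent-or-apex {o} {K} {a} {bb} {c} q tt da dbb ab bc ne na
    with one-of-three K (dist o c) (≤-pred (subst (_≤ suc (dist o c)) dbb (dist-adj≥ o bc)))
                                   (subst (λ z → dist o c ≤ suc z) dbb (dist-adj≤ o bc))
  ... | inj₁ eq = ⊥-elim (na (q bb a c dbb da eq ab (~sym bc) ne))
  ... | inj₂ (inj₂ eq) = inj₁ eq
  ... | inj₂ (inj₁ eq) with tt bb c dbb eq bc
  ...   | t , tb , tc , dt with t ≟V a
  ...     | yes refl = ⊥-elim (na tc)
  ...     | no t≢a = inj₂ (t , ~sym (q bb a t dbb da dt ab tb (λ e → t≢a (≡sym e))) , tb , tc , dt)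

  climb : ∀ {o K b a bb c s} → PredClique o K → Triangle o K →
          dist b c ≡ s → dist b a ≡ suc (suc s) → a ~ bb → bb ~ c → dist o a ≡ K → dist o bb ≡ suc K →
          (∀ t → t ~ a → t ~ bb → t ~ c → dist b t ≡ suc s → dist o t ≡ suc K) →
          dist o c ≡ suc (suc K)
  climb {b = b} {a = a} {c = c} q tt dc da ab bc dao dbbo detour
    with ascent-or-apex q tt dao dbbo ab bc (λ e → far⇒≢ b gap (≡sym e)) (far⇒≁' b gap)
    where
    gap : suc (suc (dist b c)) ≤ dist b a
    gap = ≤-reflexive (trans (cong (λ z → suc (suc z)) dc) (≡sym da))
  ... | inj₁ d = d
  ... | inj₂ (t , ta , tbb , tc , dt) = ⊥-elim (1+n≢n (trans (≡sym (detour t ta tbb tc (between b dc da ta (~sym tc)))) dt))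

module Induction (G : Graph) (conn : Connected G) (br : Bridged G) where
  open Metric G conn
  open Geodesics G conn
  open IsometricCycles G conn br
  open LocalConditions G conn

  module Step (L : ℕ) (below : ∀ K → K < L → ∀ o → PredClique o K × Triangle o K) where
    clique< : ∀ K → K < L → ∀ o → PredClique o K
    clique< K lt o = proj₁ (below K lt o)

    triangle< : ∀ K → K < L → ∀ o → Triangle o K
    triangle< K lt o = proj₂ (below K lt o)

    -- Two neighbours x, y of w with a common neighbour s two levels below w
    -- are adjacent: the clique condition around s at level 1.
    joined-from-below : 1 < L → ∀ b w x y s → suc (suc (dist b s)) ≤ dist b w → x ~ w → y ~ w → x ≢ y → s ~ x → s ~ y → x ~ y
    joined-from-below 1<L b w x y s gap xw yw xy sx sy =
      clique< 1 1<L s w x y (dist2 (far⇒≢ b gap) (far⇒≁ b gap) sx xw) (adj-dist sx) (adj-dist sy) xw yw xy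

    -- The triangle condition gives
    -- common neighbours s of x, t and s' of t, y on level L-1.  If one of them
    -- sees both x and y, joined-from-below applies; otherwise x s s' y w is an
    -- induced pentagon.
    apex-contradiction : ∀ L2 → L ≡ suc (suc L2) → ∀ b w x y t → dist b w ≡ suc L → dist b x ≡ L → dist b y ≡ L →
                         x ~ w → y ~ w → x ≢ y → ¬ (x ~ y) → dist b t ≡ L → t ~ x → t ~ y → ⊥
    apex-contradiction L2 refl b w x y t dw dx dy xw yw xy nxy dt tx ty
      with triangle< (suc L2) ≤-refl b x t dx dt (~sym tx) | triangle< (suc L2) ≤-refl b t y dt dy ty
    ... | s , sx , st , ds | s' , s't , s'y , ds' with Adj? G s y | Adj? G s' x
    ...   | yes sy | _ = nxy (joined-from-below (s≤s (s≤s z≤n)) b w x y s (two-below b s w dw ds) xw yw xy sx sy)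
    ...   | no nsy | yes s'x = nxy (joined-from-below (s≤s (s≤s z≤n)) b w x y s' (two-below b s' w dw ds') xw yw xy s'x s'y)
    ...   | no nsy | no ns'x with s ≟V s'
    ...     | yes refl = nsy s'y
    ...     | no ss' = Pentagon.impossible x s s' y w (~sym sx) ss'adj s'y yw (~sym xw)
                 (dist≥2 (levels≢ b (λ e → 1+n≢n (trans (≡sym dx) (trans e ds')))) (λ a → ns'x (~sym a)))
                 (dist≥2 (levels≢ b (λ e → 1+n≢n (trans (≡sym dy) (trans (≡sym e) ds)))) nsy)
                 (dist≥2 (far⇒≢ b (two-below b s' w dw ds')) (far⇒≁ b (two-below b s' w dw ds')))
                 (dist≥2 (λ e → xy (≡sym e)) (λ a → nxy (~sym a)))
                 (dist≥2 (λ e → far⇒≢ b (two-below b s w dw ds) (≡sym e)) (far⇒≁' b (two-below b s w dw ds)))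
      where
      ss'adj : s ~ s'
      ss'adj = clique< (suc L2) ≤-refl b t s s' dt ds ds' st s't ss'

    module CliqueRivals (b w x : V) (X : ℕ → V) (gX : Geo b x L X) (dw : dist b w ≡ suc L) (xw : x ~ w) where
      module gX = Geo gX

      record Rival (y : V) (Y : ℕ → V) : Set where
        field
          gY : Geo b y L Y
          yw : y ~ w
          ne : x ≢ y
          na : ¬ (x ~ y)

      dx : dist b x ≡ L
      dx = geo-level gX

      w-neighbour-level : ∀ t → t ~ w → L ≤ dist b t
      w-neighbour-level t tw = ≤-pred (subst (_≤ suc (dist b t)) dw (dist-adj≥ b (~sym tw)))

      module FromX (i G' : ℕ) (1≤i : 1 ≤ i) (eqL : i + G' ≡ L) where
        dXb : dist b (X i) ≡ i
        dXb = gX.lev i (subst (i ≤_) eqL (m≤m+n i G'))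

        dXx : dist (X i) x ≡ G'
        dXx = trans (cong (dist (X i)) (≡sym (trans (cong X eqL) gX.end))) (geo-dist gX i G' (≤-reflexive eqL))

        dXw : dist (X i) w ≡ suc G'
        dXw = ≤-antisym up lo
          where
          up : dist (X i) w ≤ suc G'
          up = subst (λ z → dist (X i) w ≤ z) (trans (cong₂ _+_ dXx (adj-dist xw)) (+-comm G' 1)) (dist-tri (X i) x w)
          lo : suc G' ≤ dist (X i) w
          lo = level-gap b (X i) w i (suc G') dXb (trans dw (trans (cong suc (≡sym eqL)) (≡sym (+-suc i G'))))

        level-bound : ∀ t D → dist (X i) t ≡ D → dist b t ≤ i + D
        level-bound t D dt = subst (λ z → dist b t ≤ z) (cong₂ _+_ dXb dt) (dist-tri b (X i) t)

        -- For every rival (y, Y), the path X i … x w y … Y s is geodesic,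
        -- where s lies e steps below y.
        Through : ℕ → Set
        Through e = ∀ s → s + e ≡ L → e < i → ∀ y Y → Rival y Y → dist (X i) (Y s) ≡ suc (suc (G' + e))

        -- At y: an apex t over x, w, y at distance G' from X i would be X i
        -- itself (if G' = 0, impossible as t ~ x) or lie on level L, against
        -- apex-contradiction.
        through-y : Through 0
        through-y s eq _ y Y v =
          trans (cong (dist (X i)) Ys)
                (trans (no-apex (ascent-or-apex (clique< G' G'<L (X i)) (triangle< G' G'<L (X i)) dXx dXw xw (~sym yw) ne na))
                       (cong (λ z → suc (suc z)) (≡sym (+-identityʳ G'))))
          where
          open Rival v
          Ys : Y s ≡ y
          Ys = trans (cong Y (trans (≡sym (+-identityʳ s)) eq)) (Geo.end gY)
          G'<L : G' < L
          G'<L = subst (G' <_) eqL (m<n+m G' 1≤i)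
          apex-free : ∀ t → t ~ x → t ~ w → t ~ y → dist (X i) t ≡ G' → (G' ≡ 0 ⊎ Σ ℕ λ j → G' ≡ suc j) → ⊥
          apex-free t tx _ _ dt (inj₁ z) = ~irr (subst (_~ x) (trans (≡sym (dist0 (trans dt z))) (dist0 (trans dXx z))) tx)
          apex-free t tx tw ty dt (inj₂ (G2 , z)) with ≥2⇒suc-suc L (subst (2 ≤_) eqL (+-mono-≤ 1≤i (subst (1 ≤_) (≡sym z) (s≤s z≤n))))
          ... | L2 , eL2 = apex-contradiction L2 eL2 b w x y t dw dx (geo-level gY) xw yw ne na
                             (≤-antisym (subst (dist b t ≤_) eqL (level-bound t G' dt)) (w-neighbour-level t tw)) tx ty
          no-apex : dist (X i) y ≡ suc (suc G') ⊎ Σ V (λ t → t ~ x × t ~ w × t ~ y × dist (X i) t ≡ G') → dist (X i) y ≡ suc (suc G')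
          no-apex (inj₁ d) = d
          no-apex (inj₂ (t , tx , tw , ty , dt)) = ⊥-elim (apex-free t tx tw ty dt (zero⊎suc G'))

        -- One step below y: the path w – y – Y s climbs away from X i; an
        -- offending apex t would either be joined to x (apex-contradiction)
        -- or be a rival itself, which through-y places too far from X i.
        through-below-y : Through 0 → Through 1
        through-below-y at-y s eq 1<i y Y v =
          trans (climb (clique< (suc G') K<L (X i)) (triangle< (suc G') K<L (X i)) (gY.lev s s≤L)
                       (trans dw (cong suc (≡sym ss))) (subst (w ~_) (≡sym Ysy) (~sym yw)) (~sym (gY.adj s (≤-reflexive ss)))
                       dXw (trans (at-y (suc s) (trans (+-identityʳ (suc s)) ss) 0<i y Y v) (cong (λ z → suc (suc z)) (+-identityʳ G')))
                       detour)
                (cong (λ z → suc (suc z)) (≡sym (+-comm G' 1)))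
          where
          open Rival v
          module gY = Geo gY
          ss : suc s ≡ L
          ss = trans (+-comm 1 s) eq
          s≤L : s ≤ L
          s≤L = subst (s ≤_) ss (n≤1+n s)
          0<i : 0 < i
          0<i = <-trans (s≤s z≤n) 1<i
          Ysy : Y (suc s) ≡ y
          Ysy = trans (cong Y ss) gY.end
          K<L : suc G' < L
          K<L = subst (suc G' <_) eqL (+-monoˡ-≤ G' 1<i)
          detour : ∀ t → t ~ w → t ~ Y (suc s) → t ~ Y s → dist b t ≡ suc s → dist (X i) t ≡ suc (suc G')
          detour t tw tbb tc dts with t ≟V x | Adj? G x t
          ... | yes refl | _ = ⊥-elim (na (subst (t ~_) Ysy tbb))
          ... | no t≢x | yes xt with ≥2⇒suc-suc L (subst (2 ≤_) eqL (≤-trans 1<i (m≤m+n i G')))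
          ...   | L2 , eL2 = ⊥-elim (apex-contradiction L2 eL2 b w x y t dw dx (geo-level gY) xw yw ne na
                                       (trans dts ss) (~sym xt) (subst (t ~_) Ysy tbb))
          detour t tw tbb tc dts | no t≢x | no nxt =
            trans (cong (dist (X i)) (≡sym (update-at Y L t)))
                  (trans (at-y L (+-identityʳ L) 0<i t (update Y L t) rival) (cong (λ z → suc (suc z)) (+-identityʳ G')))
            where
            rival : Rival t (update Y L t)
            rival = record { gY = geo-update-end gY ss (trans dts ss) (~sym tc) ; yw = tw ; ne = λ e → t≢x (≡sym e) ; na = nxt }

        -- Further below y: the same along Y; an offending apex t replaces Y (s+1).
        through-inner : ∀ e → Through e → Through (suc e) → Through (suc (suc e))
        through-inner e at-e at-e1 s eq e<i y Y v =
          trans (climb (clique< K K<L (X i)) (triangle< K K<L (X i)) (gY.lev s (≤-trans (n≤1+n s) (≤-trans (n≤1+n (suc s)) s2L)))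
                       (gY.lev (suc (suc s)) s2L) (~sym (gY.adj (suc s) s2L)) (~sym (gY.adj s (≤-trans (n≤1+n (suc s)) s2L)))
                       (at-e (suc (suc s)) e2 (<-trans (<-trans (n<1+n e) (n<1+n (suc e))) e<i) y Y v)
                       (trans (at-e1 (suc s) e1 (<-trans (n<1+n (suc e)) e<i) y Y v) (cong (λ z → suc (suc z)) (+-suc G' e)))
                       detour)
                (cong (λ z → suc (suc z)) (≡sym (trans (+-suc G' (suc e)) (cong suc (+-suc G' e)))))
          where
          open Rival v
          module gY = Geo gY
          e1 : suc s + suc e ≡ L
          e1 = trans (≡sym (+-suc s (suc e))) eq
          e2 : suc (suc s) + e ≡ L
          e2 = trans (cong suc (≡sym (+-suc s e))) e1
          s2L : suc (suc s) ≤ L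
          s2L = subst (suc (suc s) ≤_) e2 (m≤m+n (suc (suc s)) e)
          K : ℕ
          K = suc (suc (G' + e))
          K<L : K < L
          K<L = subst₂ _≤_ (trans (+-suc G' (suc (suc e))) (cong suc (trans (+-suc G' (suc e)) (cong suc (+-suc G' e)))))
                  (trans (+-comm G' i) eqL) (+-monoʳ-≤ G' e<i)
          detour : ∀ t → t ~ Y (suc (suc s)) → t ~ Y (suc s) → t ~ Y s → dist b t ≡ suc s → dist (X i) t ≡ suc K
          detour t ta _ tc dts =
            trans (cong (dist (X i)) (≡sym (update-at Y (suc s) t)))
                  (trans (at-e1 (suc s) e1 (<-trans (n<1+n (suc e)) e<i) y (update Y (suc s) t) rival) (cong (λ z → suc (suc z)) (+-suc G' e)))
            where
            rival : Rival y (update Y (suc s) t)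
            rival = record { gY = geo-update-inner s gY s2L dts (~sym tc) ta ; yw = yw ; ne = ne ; na = na }

        through : ∀ e → Through e
        through zero = through-y
        through (suc zero) = through-below-y through-y
        through (suc (suc e)) = through-inner e (through e) (through (suc e))

      -- Opposite vertices of the cycle X, w, Y (reversed) are L+1 apart.
      rival-far : ∀ i G' → 1 ≤ i → i + G' ≡ L → ∀ y Y → Rival y Y → suc L ≤ dist (X i) (Y (suc G'))
      rival-far (suc i') G' 1≤i eqL y Y v =
        ≤-reflexive (≡sym (trans (FromX.through (suc i') G' 1≤i eqL i' (suc G') e1 ≤-refl y Y v) (cong suc e1)))
        where
        e1 : suc G' + i' ≡ L
        e1 = trans (cong suc (+-comm G' i')) eqL

    module TriangleRivals (clique-L : ∀ o → PredClique o L) (b y : V) (X : ℕ → V) (gX : Geo b y (suc L) X) where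
      module gX = Geo gX

      NoCommon : V → V → Set
      NoCommon y y' = ∀ s → s ~ y → s ~ y' → dist b s ≡ L → ⊥

      record Partner (y' : V) (Y : ℕ → V) : Set where
        field
          gY : Geo b y' (suc L) Y
          yy' : y ~ y'
          nc : NoCommon y y'

      dy : dist b y ≡ suc L
      dy = geo-level gX

      clique≤ : ∀ K → K ≤ L → ∀ o → PredClique o K
      clique≤ K le o with m≤n⇒m<n∨m≡n le
      ... | inj₁ lt = clique< K lt o
      ... | inj₂ refl = clique-L o

      y-neighbour-level : ∀ t → t ~ y → L ≤ dist b t
      y-neighbour-level t ty = ≤-pred (subst (_≤ suc (dist b t)) dy (dist-adj≥ b (~sym ty)))

      -- If y' is a partner and t ~ y' is a further neighbour of y on level
      -- L+1 adjacent to a neighbour c of y' on level L, then t is a partner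
      -- as well: a common lower neighbour s of y and t would be adjacent to c
      -- (clique condition at t), and then to y, making c a common neighbour
      -- of y and y'.
      partner-inherited : 1 ≤ L → ∀ y' t c → y ~ y' → NoCommon y y' → dist b y' ≡ suc L → dist b t ≡ suc L →
                          dist b c ≡ L → c ~ y' → t ~ c → NoCommon y t
      partner-inherited 1≤L y' t c yy' nc dy' dt dc cy' tc s sy st ds with s ≟V c
      ... | yes refl = nc s sy cy' dc
      ... | no s≢c = nc c (~sym yc) cy' dc
        where
        sc : s ~ c
        sc = clique-L b t s c dt ds dc st (~sym tc) s≢c
        dsy' : dist s y' ≡ 2
        dsy' = dist2 (levels≢ b (λ e → 1+n≢n (≡sym (trans (≡sym ds) (trans e dy')))))
                     (λ a → nc s sy a ds) sy yy'
        yc : y ~ c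
        yc = clique≤ 1 1≤L s y' y c dsy' (adj-dist sy) (adj-dist sc) yy' cy'
               (levels≢ b (λ e → 1+n≢n (trans (≡sym dy) (trans e dc))))

      module FromX (i G' : ℕ) (1≤i : 1 ≤ i) (eqL : i + G' ≡ suc L) where
        dXb : dist b (X i) ≡ i
        dXb = gX.lev i (subst (i ≤_) eqL (m≤m+n i G'))

        dXy : dist (X i) y ≡ G'
        dXy = trans (cong (dist (X i)) (≡sym (trans (cong X eqL) gX.end))) (geo-dist gX i G' (≤-reflexive eqL))

        level-bound : ∀ t D → dist (X i) t ≡ D → dist b t ≤ i + D
        level-bound t D dt = subst (λ z → dist b t ≤ z) (cong₂ _+_ dXb dt) (dist-tri b (X i) t)

        -- For every partner (y', Y), the path X i … y y' … Y s is geodesic,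
        -- where s lies e steps below y'.
        Through : ℕ → Set
        Through e = ∀ s → s + e ≡ suc L → e < i → ∀ y' Y → Partner y' Y → dist (X i) (Y s) ≡ suc (G' + e)

        -- A partner y' is at distance G'+1 from X i: an apex over the
        -- predecessor of y on X, y and y' would be a common neighbour of y
        -- and y' on level L.
        partner-distance : ∀ y' → y ~ y' → NoCommon y y' → dist b y' ≡ suc L → dist (X i) y' ≡ suc G'
        partner-distance y' yy' nc dy' = by-cases (zero⊎suc G')
          where
          by-cases : (G' ≡ 0 ⊎ Σ ℕ λ j → G' ≡ suc j) → dist (X i) y' ≡ suc G'
          by-cases (inj₁ z) = trans (cong (λ o → dist o y') (dist0 (trans dXy z))) (trans (adj-dist yy') (cong suc (≡sym z)))
          by-cases (inj₂ (G2 , z)) = no-apex (ascent-or-apex (clique< G2 G2<L (X i)) (triangle< G2 G2<L (X i)) da (trans dXy z) ab yy'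
                                                (levels≢ b ane) ana)
            where
            eL : i + G2 ≡ L
            eL = suc-injective (trans (≡sym (+-suc i G2)) (trans (cong (i +_) (≡sym z)) eqL))
            G2<L : G2 < L
            G2<L = subst (G2 <_) eL (m<n+m G2 1≤i)
            da : dist (X i) (X (i + G2)) ≡ G2
            da = geo-dist gX i G2 (≤-trans (≤-reflexive eL) (n≤1+n L))
            ab : X (i + G2) ~ y
            ab = subst (X (i + G2) ~_) (trans (cong X (cong suc eL)) gX.end) (gX.adj (i + G2) (s≤s (≤-reflexive eL)))
            dA : dist b (X (i + G2)) ≡ L
            dA = trans (gX.lev (i + G2) (≤-trans (≤-reflexive eL) (n≤1+n L))) eL
            ane : dist b (X (i + G2)) ≢ dist b y'
            ane e = 1+n≢n (≡sym (trans (≡sym dA) (trans e dy')))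
            ana : ¬ (X (i + G2) ~ y')
            ana a = nc (X (i + G2)) ab a dA
            no-apex : dist (X i) y' ≡ suc (suc G2) ⊎ Σ V (λ t → t ~ X (i + G2) × t ~ y × t ~ y' × dist (X i) t ≡ G2) →
                      dist (X i) y' ≡ suc G'
            no-apex (inj₁ d) = trans d (cong suc (≡sym z))
            no-apex (inj₂ (t , _ , ty , ty' , dt)) =
              ⊥-elim (nc t ty ty' (≤-antisym (subst (dist b t ≤_) eL (level-bound t G2 dt)) (y-neighbour-level t ty)))

        through-y' : Through 0
        through-y' s eq _ y' Y v =
          trans (cong (dist (X i)) (trans (cong Y (trans (≡sym (+-identityʳ s)) eq)) (Geo.end gY)))
                (trans (partner-distance y' yy' nc (geo-level gY)) (cong suc (≡sym (+-identityʳ G'))))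
          where
          open Partner v

        -- One step below y': the path y – y' – Y s moves away from X i.  An
        -- apex t over it lies on level L+1 (not L, as y and y' have no common
        -- neighbour there) and so is a partner by partner-inherited, which
        -- through-y' places too far from X i.
        through-below-y' : Through 0 → Through 1
        through-below-y' at-y' s eq 1<i y' Y v =
          trans (no-apex (ascent-or-apex (clique< G' G'<L (X i)) (triangle< G' G'<L (X i)) dXy
                            (trans (at-y' (suc s) (trans (+-identityʳ (suc s)) ss) 0<i y' Y v) (cong suc (+-identityʳ G')))
                            (subst (y ~_) (≡sym Ysy) yy') (~sym (gY.adj s (≤-reflexive ss))) y≢Ys y≁Ys))
                (cong suc (≡sym (+-comm G' 1)))
          where
          open Partner v
          module gY = Geo gY
          ss : suc s ≡ suc L
          ss = trans (+-comm 1 s) eq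
          0<i : 0 < i
          0<i = <-trans (s≤s z≤n) 1<i
          Ysy : Y (suc s) ≡ y'
          Ysy = trans (cong Y ss) gY.end
          G'<L : G' < L
          G'<L = ≤-pred (subst (suc G' <_) eqL (+-monoˡ-≤ G' 1<i))
          dYs : dist b (Y s) ≡ L
          dYs = trans (gY.lev s (≤-trans (n≤1+n s) (≤-reflexive ss))) (suc-injective ss)
          Ys~y' : Y s ~ y'
          Ys~y' = subst (Y s ~_) Ysy (gY.adj s (≤-reflexive ss))
          y≢Ys : y ≢ Y s
          y≢Ys = levels≢ b (λ e → 1+n≢n (trans (≡sym dy) (trans e dYs)))
          y≁Ys : ¬ (y ~ Y s)
          y≁Ys a = nc (Y s) (~sym a) Ys~y' dYs
          apex-level : ∀ t → t ~ y → t ~ y' → t ~ Y s → dist b t ≡ suc L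
          apex-level t ty ty' tc with m≤n⇒m<n∨m≡n (y-neighbour-level t ty)
          ... | inj₁ lt = ≤-antisym (subst (dist b t ≤_) (cong suc dYs) (dist-adj≤ b (~sym tc))) lt
          ... | inj₂ e = ⊥-elim (nc t ty ty' (≡sym e))
          apex-distance : ∀ t → t ~ y → t ~ y' → t ~ Y s → dist (X i) t ≡ suc G'
          apex-distance t ty ty' tc =
            trans (cong (dist (X i)) (≡sym (update-at Y (suc L) t)))
                  (trans (at-y' (suc L) (+-identityʳ (suc L)) 0<i t (update Y (suc L) t) partner) (cong suc (+-identityʳ G')))
            where
            partner : Partner t (update Y (suc L) t)
            partner = record { gY = geo-update-end gY ss (apex-level t ty ty' tc) (~sym tc) ; yy' = ~sym ty
                             ; nc = partner-inherited (≤-pred (subst (2 ≤_) eqL (≤-trans 1<i (m≤m+n i G'))))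
                                      y' t (Y s) yy' nc (geo-level gY) (apex-level t ty ty' tc) dYs Ys~y' tc }
          no-apex : dist (X i) (Y s) ≡ suc (suc G') ⊎ Σ V (λ t → t ~ y × t ~ Y (suc s) × t ~ Y s × dist (X i) t ≡ G') →
                    dist (X i) (Y s) ≡ suc (suc G')
          no-apex (inj₁ d) = d
          no-apex (inj₂ (t , ty , tbb , tc , dt)) = ⊥-elim (1+n≢n (trans (≡sym (apex-distance t ty (subst (t ~_) Ysy tbb) tc)) dt))

        -- Further below y': along Y; an offending apex t replaces Y (s+1).
        through-inner : ∀ e → Through e → Through (suc e) → Through (suc (suc e))
        through-inner e at-e at-e1 s eq e<i y' Y v =
          trans (climb (clique< K K<L (X i)) (triangle< K K<L (X i)) (gY.lev s (≤-trans (n≤1+n s) (≤-trans (n≤1+n (suc s)) s2L)))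
                       (gY.lev (suc (suc s)) s2L) (~sym (gY.adj (suc s) s2L)) (~sym (gY.adj s (≤-trans (n≤1+n (suc s)) s2L)))
                       (at-e (suc (suc s)) e2 (<-trans (<-trans (n<1+n e) (n<1+n (suc e))) e<i) y' Y v)
                       (trans (at-e1 (suc s) e1 (<-trans (n<1+n (suc e)) e<i) y' Y v) (cong suc (+-suc G' e)))
                       detour)
                (cong suc (≡sym (trans (+-suc G' (suc e)) (cong suc (+-suc G' e)))))
          where
          open Partner v
          module gY = Geo gY
          e1 : suc s + suc e ≡ suc L
          e1 = trans (≡sym (+-suc s (suc e))) eq
          e2 : suc (suc s) + e ≡ suc L
          e2 = trans (cong suc (≡sym (+-suc s e))) e1
          s2L : suc (suc s) ≤ suc L
          s2L = subst (suc (suc s) ≤_) e2 (m≤m+n (suc (suc s)) e)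
          K : ℕ
          K = suc (G' + e)
          K<L : K < L
          K<L = ≤-pred (subst₂ _≤_ (trans (+-suc G' (suc (suc e))) (cong suc (trans (+-suc G' (suc e)) (cong suc (+-suc G' e)))))
                  (trans (+-comm G' i) eqL) (+-monoʳ-≤ G' e<i))
          detour : ∀ t → t ~ Y (suc (suc s)) → t ~ Y (suc s) → t ~ Y s → dist b t ≡ suc s → dist (X i) t ≡ suc K
          detour t ta _ tc dts =
            trans (cong (dist (X i)) (≡sym (update-at Y (suc s) t)))
                  (trans (at-e1 (suc s) e1 (<-trans (n<1+n (suc e)) e<i) y' (update Y (suc s) t) partner) (cong suc (+-suc G' e)))
            where
            partner : Partner y' (update Y (suc s) t)
            partner = record { gY = geo-update-inner s gY s2L dts (~sym tc) ta ; yy' = yy' ; nc = nc }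

        through : ∀ e → Through e
        through zero = through-y'
        through (suc zero) = through-below-y' through-y'
        through (suc (suc e)) = through-inner e (through e) (through (suc e))

      -- Opposite vertices of the cycle X, Y (reversed) are L+1 apart: X i
      -- faces Y (G'+1) ...
      partner-far : ∀ i G' → 1 ≤ i → i + G' ≡ suc L → ∀ y' Y → Partner y' Y → suc L ≤ dist (X i) (Y (suc G'))
      partner-far (suc i') G' 1≤i eqL y' Y v =
        ≤-reflexive (≡sym (trans (FromX.through (suc i') G' 1≤i eqL i' (suc G') e1 ≤-refl y' Y v) e1))
        where
        e1 : suc G' + i' ≡ suc L
        e1 = trans (cong suc (+-comm G' i')) eqL

      -- … and, going round the other way, Y G': the path from Y (G'+2) (or
      -- from y, when i = 1) through Y (G'+1) cannot descend towards X i.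
      partner-far' : ∀ i G' → 1 ≤ i → i + G' ≡ suc L → ∀ y' Y → Partner y' Y → suc L ≤ dist (X i) (Y G')
      partner-far' (suc zero) G' 1≤i eqL y' Y v =
        no-descent (clique-L (X 1)) da (trans (FromX.through 1 G' 1≤i eqL 0 (suc G') (trans (+-identityʳ (suc G')) (cong suc G'L)) (s≤s z≤n) y' Y v)
                          (cong suc (trans (+-identityʳ G') G'L)))
                   (subst (y ~_) (≡sym YsG) yy') (~sym (gY.adj G' (s≤s (≤-reflexive G'L)))) y≢YG y≁YG
        where
        open Partner v
        module gY = Geo gY
        G'L : G' ≡ L
        G'L = suc-injective eqL
        da : dist (X 1) y ≡ L
        da = trans (FromX.dXy 1 G' 1≤i eqL) G'L
        YsG : Y (suc G') ≡ y'
        YsG = trans (cong (λ z → Y (suc z)) G'L) gY.end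
        dYG : dist b (Y G') ≡ L
        dYG = trans (gY.lev G' (≤-trans (≤-reflexive G'L) (n≤1+n L))) G'L
        y≢YG : y ≢ Y G'
        y≢YG = levels≢ b (λ e → 1+n≢n (trans (≡sym dy) (trans e dYG)))
        y≁YG : ¬ (y ~ Y G')
        y≁YG a = nc (Y G') (~sym a) (subst (Y G' ~_) YsG (gY.adj G' (s≤s (≤-reflexive G'L)))) dYG
      partner-far' (suc (suc i')) G' 1≤i eqL y' Y v =
        no-descent (clique-L (X i)) da dbb (~sym (gY.adj (suc G') s2L)) (~sym (gY.adj G' (≤-trans (n≤1+n _) s2L)))
                   (λ e → far⇒≢ b gap (≡sym e)) (far⇒≁' b gap)
        where
        open Partner v
        module gY = Geo gY
        i : ℕ
        i = suc (suc i')
        eL : G' + suc i' ≡ L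
        eL = trans (+-comm G' (suc i')) (suc-injective eqL)
        e2 : suc (suc G') + i' ≡ suc L
        e2 = cong suc (trans (≡sym (+-suc G' i')) eL)
        s2L : suc (suc G') ≤ suc L
        s2L = subst (suc (suc G') ≤_) e2 (m≤m+n (suc (suc G')) i')
        da : dist (X i) (Y (suc (suc G'))) ≡ L
        da = trans (FromX.through i G' 1≤i eqL i' (suc (suc G')) e2 (<-trans (n<1+n i') (n<1+n (suc i'))) y' Y v)
               (trans (≡sym (+-suc G' i')) eL)
        dbb : dist (X i) (Y (suc G')) ≡ suc L
        dbb = trans (FromX.through i G' 1≤i eqL (suc i') (suc G') (cong suc eL) ≤-refl y' Y v) (cong suc eL)
        gap : suc (suc (dist b (Y G'))) ≤ dist b (Y (suc (suc G')))
        gap = subst₂ _≤_ (cong (λ z → suc (suc z)) (≡sym (gY.lev G' (≤-trans (n≤1+n G') (≤-trans (n≤1+n _) s2L)))))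
                (≡sym (gY.lev (suc (suc G')) s2L)) ≤-refl

    -- If the clique condition failed at level L ≥ 1 for non-adjacent x, y
    -- under w, the geodesics from b to x and to y would close up through w
    -- into a closed walk of length 2L+2 whose opposite vertices are L+1 apart.
    clique-cycle : 1 ≤ L → ∀ b w x y → dist b w ≡ suc L → dist b x ≡ L → dist b y ≡ L →
                   x ~ w → y ~ w → x ≢ y → ¬ (x ~ y) → ⊥
    clique-cycle 1≤L b w x y dw dx dy xw yw ne na = C.unbalanced ≤-refl (n≤1+n (suc L)) (s≤s 1≤L) far
      where
      X : ℕ → V
      X = proj₁ (geodesic b x L dx)
      gX : Geo b x L X
      gX = proj₂ (geodesic b x L dx)
      Y : ℕ → V
      Y = proj₁ (geodesic b y L dy)
      gY : Geo b y L Y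
      gY = proj₂ (geodesic b y L dy)
      module R1 = CliqueRivals b w x X gX dw xw
      module R2 = CliqueRivals b w y Y gY dw yw
      gXw : Geo b w (suc L) (extend X L w)
      gXw = geo-extend gX xw dw
      module C = Bigon (suc L) (suc L) (suc L) L (cong suc (+-suc L L)) 1≤L (extend X L w) Y
                   (trans (geo-start gXw) (≡sym (geo-start gY))) (Geo.adj gXw) (Geo.adj gY)
                   (subst₂ _~_ (≡sym (Geo.end gXw)) (≡sym (Geo.end gY)) (~sym yw))
      open C using (c; cA; cB; per)
      cX : ∀ k → k ≤ L → c k ≡ X k
      cX k le = trans (cA k (≤-trans le (n≤1+n L))) (extend-≤ X L w k le)
      cw : c (suc L) ≡ w
      cw = trans (cA (suc L) ≤-refl) (Geo.end gXw)
      c0 : c 0 ≡ b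
      c0 = trans (cA 0 z≤n) (geo-start gXw)
      index-X : ∀ p L G' → (p + suc L) + suc G' ≡ suc L + suc (p + G')
      index-X = solve-∀
      index-Y : ∀ L o j → (suc L + suc o) + suc j ≡ suc L + suc (suc j + o)
      index-Y = solve-∀
      index-wrap : ∀ L o → (suc L + suc o) + suc L ≡ suc o + (suc L + suc L)
      index-wrap = solve-∀
      -- X (p'+1) faces the vertex of Y that is G'+1 steps below y.
      far-X-side : ∀ p' G' → suc p' + G' ≡ L → suc L ≤ dist (c (suc p')) (c (suc p' + suc L))
      far-X-side p' G' eq =
        subst₂ (λ a b' → suc L ≤ dist a b') (≡sym (cX (suc p') (subst (suc p' ≤_) eq (m≤m+n (suc p') G'))))
          (≡sym (cB (suc p' + suc L) (suc G') (trans (index-X (suc p') L G') (cong (λ z → suc L + suc z) eq)) (s≤s z≤n)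
                   (subst (suc G' ≤_) eq (s≤s (m≤n+m G' p')))))
          (R1.rival-far (suc p') G' (s≤s z≤n) eq y Y (record { gY = gY ; yw = yw ; ne = ne ; na = na }))
      -- Symmetrically, past w the walk runs down Y, facing X.
      far-Y-side : ∀ o → suc L + suc o < suc L + suc L → suc L ≤ dist (c (suc L + suc o)) (c (suc L + suc o + suc L))
      far-Y-side o p<m with m≤n⇒∃[o]m+o≡n (≤-pred (+-cancelˡ-≤ (suc L) (suc (suc o)) (suc L)
                              (subst (_≤ suc L + suc L) (≡sym (+-suc (suc L) (suc o))) p<m)))
      ... | j , ej = subst₂ (λ a b' → suc L ≤ dist a b')
                      (≡sym (cB (suc L + suc o) (suc j) (trans (index-Y L o j) (cong (λ z → suc L + suc z) eL)) (s≤s z≤n)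
                               (subst (suc j ≤_) eL (s≤s (m≤m+n j o)))))
                      (≡sym (trans (cong c (index-wrap L o)) (trans (per (suc o)) (cX (suc o) (subst (suc o ≤_) eL (s≤s (m≤n+m o j)))))))
                      (R2.rival-far (suc j) o (s≤s z≤n) eL x X
                         (record { gY = gX ; yw = xw ; ne = λ e → ne (≡sym e) ; na = λ a → na (~sym a) }))
        where
        eL : suc j + o ≡ L
        eL = trans (cong suc (+-comm j o)) ej
      far : ∀ p → p < suc L + suc L → suc L ≤ dist (c p) (c (p + suc L))
      far zero _ = ≤-reflexive (≡sym (trans (cong₂ dist c0 cw) dw))
      far (suc p') p<m with suc p' ≤? L
      ... | yes p≤L with m≤n⇒∃[o]m+o≡n p≤L
      ...   | G' , eq = far-X-side p' G' eq
      far (suc p') p<m | no p≰L with m≤n⇒m<n∨m≡n (≰⇒> p≰L)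
      ...   | inj₂ refl = ≤-reflexive (≡sym (trans (cong₂ dist cw (trans (per 0) c0)) (trans (dist-sym w b) dw)))
      ...   | inj₁ sL<p with m≤n⇒∃[o]m+o≡n sL<p
      ...     | o , refl = subst (λ q → suc L ≤ dist (c q) (c (q + suc L))) (+-suc (suc L) o)
                             (far-Y-side o (subst (_< suc L + suc L) (≡sym (+-suc (suc L) o)) p<m))

    clique-at-L : ∀ b → PredClique b L
    clique-at-L b w x y dw dx dy xw yw ne with Adj? G x y | zero⊎suc L
    ... | yes a | _ = a
    ... | no na | inj₁ z = ⊥-elim (ne (trans (≡sym (dist0 (trans dx z))) (dist0 (trans dy z))))
    ... | no na | inj₂ (L' , z) = ⊥-elim (clique-cycle (subst (1 ≤_) (≡sym z) (s≤s z≤n)) b w x y dw dx dy xw yw ne na)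

    -- If the triangle condition failed at level L ≥ 1 for y ~ y', the
    -- geodesics from b to y and to y' would close up into a closed walk of
    -- length 2L+3 whose vertices L+1 steps apart are at distance ≥ L+1.
    triangle-cycle : (∀ o → PredClique o L) → 1 ≤ L → ∀ b y y' → dist b y ≡ suc L → dist b y' ≡ suc L → y ~ y' →
                     (∀ s → s ~ y → s ~ y' → dist b s ≡ L → ⊥) → ⊥
    triangle-cycle clique-L 1≤L b y y' dy dy' yy' nc = C.unbalanced (n≤1+n (suc L)) ≤-refl (s≤s 1≤L) far
      where
      X : ℕ → V
      X = proj₁ (geodesic b y (suc L) dy)
      gX : Geo b y (suc L) X
      gX = proj₂ (geodesic b y (suc L) dy)
      Y : ℕ → V
      Y = proj₁ (geodesic b y' (suc L) dy')
      gY : Geo b y' (suc L) Y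
      gY = proj₂ (geodesic b y' (suc L) dy')
      module T = TriangleRivals clique-L b y X gX
      partner : T.Partner y' Y
      partner = record { gY = gY ; yy' = yy' ; nc = nc }
      module C = Bigon (suc L) (suc (suc L)) (suc L) (suc L) (cong suc (+-suc L (suc L))) (s≤s z≤n) X Y
                   (trans (geo-start gX) (≡sym (geo-start gY))) (Geo.adj gX) (Geo.adj gY)
                   (subst₂ _~_ (≡sym (Geo.end gX)) (≡sym (Geo.end gY)) yy')
      open C using (c; cA; cB; per)
      c0 : c 0 ≡ b
      c0 = trans (cA 0 z≤n) (geo-start gX)
      index-X : ∀ p L G' → (p + suc L) + suc G' ≡ suc L + suc (p + G')
      index-X = solve-∀
      index-wrap : ∀ L o → suc L + suc o + suc L ≡ o + (suc L + suc (suc L))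
      index-wrap = solve-∀
      index-Y : ∀ L o G2 → (suc L + suc o) + G2 ≡ suc L + (suc o + G2)
      index-Y = solve-∀
      -- X (p'+1) faces the vertex of Y that is G'+1 steps below y'.
      far-X-side : ∀ p' G' → suc p' + G' ≡ suc L → suc L ≤ dist (c (suc p')) (c (suc p' + suc L))
      far-X-side p' G' eq =
        subst₂ (λ a b' → suc L ≤ dist a b') (≡sym (cA (suc p') (subst (suc p' ≤_) eq (m≤m+n (suc p') G'))))
          (≡sym (cB (suc p' + suc L) (suc G') (trans (index-X (suc p') L G') (cong (λ q → suc L + suc q) eq)) (s≤s z≤n)
                   (subst (suc G' ≤_) eq (s≤s (m≤n+m G' p')))))
          (T.partner-far (suc p') G' (s≤s z≤n) eq y' Y partner)
      -- Past y' the walk runs down Y, facing X one step further round.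
      Y-facing-X : ∀ o G2 → suc L ≡ suc (o + G2) → suc L ≤ dist (Y (suc G2)) (X o)
      Y-facing-X zero G2 e = ≤-reflexive (≡sym (trans (cong₂ dist (trans (cong Y (≡sym e)) (Geo.end gY)) (geo-start gX))
                               (trans (dist-sym y' b) dy')))
      Y-facing-X (suc o') G2 e = subst (suc L ≤_) (dist-sym (X (suc o')) (Y (suc G2)))
                                   (T.partner-far' (suc o') (suc G2) (s≤s z≤n) (trans (+-suc (suc o') G2) (≡sym e)) y' Y partner)
      far-Y-side : ∀ o → suc L + suc o < suc L + suc (suc L) → suc L ≤ dist (c (suc L + suc o)) (c (suc L + suc o + suc L))
      far-Y-side o p<m with m≤n⇒∃[o]m+o≡n (≤-pred (+-cancelˡ-≤ (suc L) (suc (suc o)) (suc (suc L))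
                              (subst (_≤ suc L + suc (suc L)) (≡sym (+-suc (suc L) (suc o))) p<m)))
      ... | G2 , eG = subst₂ (λ a b' → suc L ≤ dist a b')
                        (≡sym (cB (suc L + suc o) (suc G2) (trans (index-Y L o (suc G2)) (cong (λ q → suc L + suc q) (trans (+-suc o G2) eG)))
                                 (s≤s z≤n) (s≤s (subst (G2 ≤_) (suc-injective eG) (m≤n+m G2 o)))))
                        (≡sym (trans (cong c (index-wrap L o)) (trans (per o) (cA o (≤-trans (n≤1+n o) (s≤s (subst (o ≤_) (suc-injective eG) (m≤m+n o G2))))))))
                        (Y-facing-X o G2 (≡sym eG))
      far : ∀ p → p < suc L + suc (suc L) → suc L ≤ dist (c p) (c (p + suc L))
      far zero _ = ≤-reflexive (≡sym (trans (cong₂ dist c0 (trans (cA (suc L) ≤-refl) (Geo.end gX))) dy))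
      far (suc p') p<m with suc p' ≤? suc L
      ... | yes p≤L with m≤n⇒∃[o]m+o≡n p≤L
      ...   | G' , eq = far-X-side p' G' eq
      far (suc p') p<m | no p≰L with m≤n⇒∃[o]m+o≡n (≰⇒> p≰L)
      ...   | o , refl = subst (λ q → suc L ≤ dist (c q) (c (q + suc L))) (+-suc (suc L) o)
                           (far-Y-side o (subst (_< suc L + suc (suc L)) (≡sym (+-suc (suc L) o)) p<m))

    triangle-at-L : (∀ o → PredClique o L) → ∀ b → Triangle b L
    triangle-at-L clique-L b y y' dy dy' yy' with any? (λ t → Adj? G t y ×-dec Adj? G t y' ×-dec (dist b t ≟ L)) | zero⊎suc L
    ... | yes (t , ty , ty' , dt) | _ = t , ty , ty' , dt
    ... | no none | inj₁ z = ⊥-elim (none (b , dist1 (trans dy (cong suc z)) , dist1 (trans dy' (cong suc z)) , trans (dist-self b) (≡sym z)))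
    ... | no none | inj₂ (L' , z) = ⊥-elim (triangle-cycle clique-L (subst (1 ≤_) (≡sym z) (s≤s z≤n)) b y y' dy dy' yy'
                                              (λ s sy sy' ds → none (s , sy , sy' , ds)))

  local-conditions : ∀ L o → PredClique o L × Triangle o L
  local-conditions = <-rec (λ L → ∀ o → PredClique o L × Triangle o L)
    (λ L below o → Step.clique-at-L L (λ K lt → below lt) o
                 , Step.triangle-at-L L (λ K lt → below lt) (Step.clique-at-L L (λ K lt → below lt)) o)

module Projection (G : Graph) (conn : Connected G) (k4 : K4Free G) (br : Bridged G) (z u : Vtx G) where
  open Metric G conn
  open LocalConditions G conn
  open Induction G conn br using (local-conditions)

  clique : ∀ K → PredClique u K
  clique K = proj₁ (local-conditions K u)

  triangle : ∀ K → Triangle u K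
  triangle K = proj₂ (local-conditions K u)

  Lower : ℕ → V → Set
  Lower d a = z ~ a × dist u a ≡ d

  below-z : ∀ d → dist u z ≡ suc d → ∀ b → InN G z b → d ≤ dist u b
  below-z d e b (inj₁ refl) = subst (d ≤_) (≡sym e) (n≤1+n d)
  below-z d e b (inj₂ zb) = ≤-pred (subst (_≤ suc (dist u b)) e (dist-adj≥ u zb))

  projection-lower : ∀ d → dist u z ≡ suc d → ∀ a → InProj G u z a ⇔ Lower d a
  projection-lower d e a = mk⇔ to from
    where
    to : InProj G u z a → Lower d a
    to (inN , k , Dk , least-k) with predecessor u z d e
    ... | w , wz , dw = z~a inN , da
      where
      da : dist u a ≡ d
      da = ≤-antisym (subst (_≤ d) (Dist-unique Dk) (least-k w d (inj₂ (~sym wz)) (subst (Dist G u w) dw (dist-Dist u w))))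
                     (below-z d e a inN)
      z~a : InN G z a → z ~ a
      z~a (inj₁ refl) = ⊥-elim (1+n≢n (trans (≡sym e) da))
      z~a (inj₂ za) = za
    from : Lower d a → InProj G u z a
    from (za , da) = inj₂ za , d , subst (Dist G u a) da (dist-Dist u a) ,
                     λ b m inb Db → subst (d ≤_) (≡sym (Dist-unique Db)) (below-z d e b inb)

  projection-self : dist u z ≡ 0 → ∀ a → InProj G u z a ⇔ (a ≡ z)
  projection-self e0 a = mk⇔ to from
    where
    to : InProj G u z a → a ≡ z
    to (_ , k , Dk , least-k) =
      trans (≡sym (dist0 (n≤0⇒n≡0 (subst (_≤ 0) (Dist-unique Dk) (least-k z 0 (inj₁ refl) (subst (Dist G u z) e0 (dist-Dist u z)))))))
            (dist0 e0)
    from : a ≡ z → InProj G u z a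
    from refl = inj₁ refl , 0 , subst (Dist G u a) e0 (dist-Dist u a) , λ _ _ _ _ → z≤n

  -- Lower neighbours of z are pairwise adjacent (clique condition at z) …
  lower-adjacent : ∀ d → dist u z ≡ suc d → ∀ {y y'} → Lower d y → Lower d y' → y ≢ y' → y ~ y'
  lower-adjacent d e (zy , dy) (zy' , dy') ne = clique d z _ _ e dy dy' (~sym zy) (~sym zy') ne

  -- … so, as G is K₄-free, there are at most two of them.
  lower-at-most-two : ∀ d → dist u z ≡ suc d → ∀ {y y'} → Lower d y → Lower d y' → y ≢ y' → ∀ a → Lower d a → a ≡ y ⊎ a ≡ y'
  lower-at-most-two d e {y} {y'} ly ly' ne a la with a ≟V y | a ≟V y'
  ... | yes ay | _ = inj₁ ay
  ... | no _ | yes ay' = inj₂ ay'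
  ... | no a≢y | no a≢y' = ⊥-elim (k4 z y y' a (proj₁ ly) (proj₁ ly') (proj₁ la) (lower-adjacent d e ly ly' ne)
                                      (lower-adjacent d e ly la (λ q → a≢y (≡sym q))) (lower-adjacent d e ly' la (λ q → a≢y' (≡sym q))))

  projection-shape : (∃ λ y → ∀ a → InProj G u z a ⇔ (a ≡ y))
                   ⊎ (∃ λ y → ∃ λ y' → Adj G y y' × (∀ a → InProj G u z a ⇔ (a ≡ y ⊎ a ≡ y')))
  projection-shape with dist u z in e
  ... | zero = inj₁ (z , projection-self e)
  ... | suc d with predecessor u z d e
  ...   | y , yz , dy with any? (λ a → (Adj? G z a ×-dec (dist u a ≟ d)) ×-dec ¬? (a ≟V y))
  ...     | no none = inj₁ (y , λ a → mk⇔ only-y (λ { refl → ~sym yz , dy }) ⇔-∘ projection-lower d e a)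
    where
    only-y : ∀ {a} → Lower d a → a ≡ y
    only-y {a} la with a ≟V y
    ... | yes ay = ay
    ... | no a≢y = ⊥-elim (none (a , la , a≢y))
  ...     | yes (y' , ly' , y'≢y) = inj₂ (y , y' , lower-adjacent d e ly ly' (λ q → y'≢y (≡sym q)) ,
                                     λ a → mk⇔ (lower-at-most-two d e ly ly' (λ q → y'≢y (≡sym q)) a) both ⇔-∘ projection-lower d e a)
    where
    ly : Lower d y
    ly = ~sym yz , dy
    both : ∀ {a} → a ≡ y ⊎ a ≡ y' → Lower d a
    both (inj₁ refl) = ly
    both (inj₂ refl) = ly'

  -- Two distinct lower neighbours y, y' of z are adjacent; the triangle
  -- condition gives a common neighbour on the level below, unique because two
  -- of them would be adjacent (clique condition at y) and span a K₄ with y, y'.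
  lower-apex : ∀ k {y y'} → dist u z ≡ suc k → Lower k y → Lower k y' → y ≢ y' →
               ∃! _≡_ (λ x → Adj G x y × Adj G x y' × Dist G u x (k ∸ 1))
  lower-apex zero e ly ly' ne = ⊥-elim (ne (trans (≡sym (dist0 (proj₂ ly))) (dist0 (proj₂ ly'))))
  lower-apex (suc k) {y} {y'} e ly ly' ne with triangle k y y' (proj₂ ly) (proj₂ ly') (lower-adjacent (suc k) e ly ly' ne)
  ... | x , xy , xy' , dx = x , (xy , xy' , subst (Dist G u x) dx (dist-Dist u x)) , unique
    where
    unique : ∀ {x'} → Adj G x' y × Adj G x' y' × Dist G u x' k → x ≡ x'
    unique {x'} (x'y , x'y' , Dx') with x ≟V x'
    ... | yes eq = eq
    ... | no x≢x' = ⊥-elim (k4 x x' y y' (clique k y x x' (proj₂ ly) dx (≡sym (Dist-unique Dx')) xy x'y x≢x')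
                                xy xy' x'y x'y' (lower-adjacent (suc k) e ly ly' ne))

  projection-apex : ∀ k y y' → Dist G u z (suc k) → y ≢ y' → (∀ a → InProj G u z a ⇔ (a ≡ y ⊎ a ≡ y')) →
                    ∃! _≡_ (λ x → Adj G x y × Adj G x y' × Dist G u x (k ∸ 1))
  projection-apex k y y' Dz ne proj = lower-apex k e (lower y (inj₁ refl)) (lower y' (inj₂ refl)) ne
    where
    e : dist u z ≡ suc k
    e = ≡sym (Dist-unique Dz)
    lower : ∀ a → a ≡ y ⊎ a ≡ y' → Lower k a
    lower a h = Equivalence.to (projection-lower k e a) (Equivalence.from (proj a) h)

lemma9 : (G : Graph) → Connected G → K4Free G → Bridged G →
    (z u : Vtx G) →
    ((∃ λ y → ∀ a → InProj G u z a ⇔ (a ≡ y))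
    ⊎ (∃ λ y → ∃ λ y' → Adj G y y' × (∀ a → InProj G u z a ⇔ (a ≡ y ⊎ a ≡ y'))))
    × (∀ (k : ℕ) (y y' : Vtx G) → Dist G u z (suc k) → y ≢ y'
    → (∀ a → InProj G u z a ⇔ (a ≡ y ⊎ a ≡ y'))
    → ∃! _≡_ (λ x → Adj G x y × Adj G x y' × Dist G u x (k ∸ 1)))
lemma9 G conn k4 br z u = Projection.projection-shape G conn k4 br z u , Projection.projection-apex G conn k4 br z u
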